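{- Let $b\ge1$, $g=4b^2$, and let $G$ be an extended gadget of type II with vertices $p,q,r$ and paths $P_1,P_2$ as in its definition. Then: (1) for every $x\in V(G)\setminus\{p,q\}$ there exist $a\in\{1,2\}$ and an $(a,b)$-alternating-path $R$ in $G$ with $t_a(R)=x$, $s_1(R)\in\{p,q\}$ and $|V(R)\cap\{p,q\}|=1$; (2) for every non-empty set $X\subseteq V(P_1)\setminus\{p,r\}$ there exist $a\in\{1,2\}$ and an $(a,b)$-alternating-path $R$ in $G$ with $t_a(R)\in X$, $s_1(R)\in\{p,q\}$ and $|V(R)\cap\{p,q\}|=|V(R)\cap X|=1$.
   Context: Digraphs are finite, loopless, without parallel arcs. Fix integers $b\ge1$, $g:=4b^2$. A basic type-II gadget consists of vertices $p,q,r$ and a directed path $P_1$ from $r$ to $p$ of length at least $2b^2+b-2$ with $q\notin V(P_1)$, together with an arc from every vertex of $P_1$ to $q$. An extended type-II gadget is a basic one together with an additional directed path $P_2$ of length at least $b$ whose last vertex is $r$, with $V(P_1)\cap V(P_2)=\{r\}$, $q\notin V(P_2)$, and either an arc from the first vertex of $P_2$ to the second vertex of $P_1$, or an arc from some vertex of $V(P_1)\setminus\{r\}$ to the first vertex of $P_2$. An $(a,b)$-alternating-path is an oriented path $R$ consisting of vertices $s_1,\dots,s_a,t_1,\dots,t_a$ and pairwise internally vertex-disjoint directed paths $Q_1,\dots,Q_a,Q'_1,\dots,Q'_{a-1}$, where $Q_i$ goes from $s_i$ to $t_i$, $Q'_i$ goes from $s_{i+1}$ to $t_i$, and $Q_2,\dots,Q_{a-1},Q'_1,\dots,Q'_{a-1}$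 each have length at least $b$ ($Q_1$, $Q_a$ may have length $0$). We write $s_i(R),t_i(R)$. -}

module Defs where

open import Data.Nat using (ℕ; zero; suc; _+_; _*_; _∸_; _≤_; _<_)
open import Data.Fin using (Fin)
open import Data.Fin.Properties using () renaming (_≟_ to _≟ᶠ_)
open import Data.Fin.Subset using (Subset) renaming (_∈_ to _∈ₛ_)
open import Data.Fin.Subset.Properties using () renaming (_∈?_ to _∈ₛ?_)
open import Data.List using (List; []; _∷_; _++_; length; reverse; drop; filter)
open import Data.List.Membership.Propositional using (_∈_; _∉_)
open import Data.List.Relation.Unary.Unique.Propositional using (Unique)
open import Data.Product using (Σ; ∃; _×_; _,_)
open import Data.Sum using (_⊎_)
open import Relation.Nullary using (¬_)
open import Relation.Binary.PropositionalEquality using (_≡_; _≢_)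
open import Function.Bundles using (_⇔_)

-- A finite digraph: vertex set Fin n, arc relation, loopless.
-- (Parallel arcs are excluded automatically since arcs form a relation.)
record Digraph : Set₁ where
  field
    n        : ℕ
    Arc      : Fin n → Fin n → Set
    loopless : ∀ v → ¬ Arc v v

module _ (G : Digraph) where
  open Digraph G

  V : Set
  V = Fin n

  data Walk : V → V → List V → Set where
    here : ∀ {u} → Walk u u (u ∷ [])
    step : ∀ {u w v xs} → Arc u w → Walk w v xs → Walk u v (u ∷ xs)

  DirPath : V → V → List V → Set
  DirPath u v xs = Walk u v xs × Unique xs

  len : List V → ℕ
  len xs = length xs ∸ 1

  Consec : V → V → List V → Set
  Consec x y xs = Σ (List V) λ pre → Σ (List V) λ suf → xs ≡ pre ++ (x ∷ y ∷ suf)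

  -- Number of vertices of the list lying in the vertex set S
  -- (equals |V(R) ∩ S| when the list has no repetitions).
  count : List V → Subset n → ℕ
  count xs S = length (filter (_∈ₛ? S) xs)

  -- Indices i range over 1..a (Q i, s i, t i)
  -- and 1..a-1 (Q' i); values outside these ranges are irrelevant.
  -- The oriented path R is  s₁ -Q₁→ t₁ ←Q'₁- s₂ -Q₂→ t₂ ←Q'₂- s₃ … t_a,
  -- i.e. its vertex sequence is Q₁ followed, for i = 1..a-1, by reverse(Q'ᵢ)
  -- minus its first vertex tᵢ and Q_{i+1} minus its first vertex s_{i+1}.
  altSeq : (ℕ → List V) → (ℕ → List V) → ℕ → ℕ → List V
  altSeq Q Q' i zero    = []
  altSeq Q Q' i (suc k) = drop 1 (reverse (Q' i)) ++ drop 1 (Q (suc i)) ++ altSeq Q Q' (suc i) k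

  record AltPath (a b : ℕ) : Set where
    field
      s t   : ℕ → V
      Q Q'  : ℕ → List V
      Qpath  : ∀ i → 1 ≤ i → i ≤ a → DirPath (s i) (t i) (Q i)
      Q'path : ∀ i → 1 ≤ i → i < a → DirPath (s (suc i)) (t i) (Q' i)
      Qlen   : ∀ i → 2 ≤ i → i < a → b ≤ len (Q i)
      Q'len  : ∀ i → 1 ≤ i → i < a → b ≤ len (Q' i)
    verts : List V
    verts = Q 1 ++ altSeq Q Q' 1 (a ∸ 1)
    field
      -- Together with the above
      -- this says the Q's, Q''s are pairwise internally vertex-disjoint and
      -- glue to the oriented path s₁ Q₁ t₁ Q'₁ s₂ … t_a.
      isPath : Unique verts

  -- Extended type-II gadget; G is exactly this digraph (vertex set and arc set).
  record ExtTypeII (b : ℕ) : Set where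
    field
      p q r  : V
      P₁     : List V
      P₁path : DirPath r p P₁
      P₁len  : 2 * (b * b) + b ∸ 2 ≤ len P₁
      q∉P₁   : q ∉ P₁
      u      : V
      P₂     : List V
      P₂path : DirPath u r P₂
      P₂len  : b ≤ len P₂
      P₁∩P₂  : ∀ v → v ∈ P₁ → v ∈ P₂ → v ≡ r
      q∉P₂   : q ∉ P₂
      ex ey  : V
      extra  : (ex ≡ u × Σ (List V) λ rest → P₁ ≡ r ∷ ey ∷ rest)
             ⊎ (ey ≡ u × ex ∈ P₁ × ex ≢ r)
      vertices : ∀ v → v ∈ P₁ ⊎ v ∈ P₂ ⊎ v ≡ q
      arcs : ∀ x y → Arc x y ⇔
               (Consec x y P₁ ⊎ Consec x y P₂ ⊎ (x ∈ P₁ × y ≡ q) ⊎ (x ≡ ex × y ≡ ey))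

module Submission where

-- Write P₁ = r ∷ I ++ [ p ], so that I is the interior of P₁.  The list
-- spine = P₂ ++ I is P₂ followed by the interior of P₁; it contains every
-- vertex of the gadget except p and q, and q ∷ p ∷ spine has no repetitions.
-- Every alternating path built below starts at an apex c ∈ {p, q}, and its
-- remaining vertices form, up to permutation, a sublist N of the spine
-- (a "realisation" of its terminal vertex).  This makes the two counting
-- conditions uniform: the path meets {p, q} exactly in c, and it meets a set
-- X ⊆ I exactly as often as N does.
--
-- For the gadget, vertices of P₂ are reached by running from x along
-- P₂ and the whole interior of P₁ back to q; for part (2) we case on the
-- additional arc and pick the first (or last) vertex of X along P₁.  Part (1)
-- on the interior of P₁ is part (2) for the singleton X = ⁅ x ⁆.

open import Defs
open import Data.Nat using (ℕ; suc; _+_; _*_; _∸_; _≤_; s≤s)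
open import Data.Nat.Properties
  using (≤-trans; n≤1+n; m≤n+m; +-comm; +-∸-comm; *-mono-≤; *-monoʳ-≤; m∸n≤m; m+n∸n≡m)
open import Data.Fin.Subset using (Subset; ⁅_⁆; _∪_; Nonempty)
  renaming (_∈_ to _∈ₛ_; _∉_ to _∉ₛ_)
open import Data.Fin.Subset.Properties using (x∈⁅x⁆; x∈⁅y⁆⇒x≡y; x∈p∪q⁻; p⊆p∪q; q⊆p∪q)
  renaming (_∈?_ to _∈ₛ?_)
open import Data.List using (List; []; _∷_; _++_; [_]; length; reverse; drop)
open import Data.List.Properties
  using (++-assoc; ++-identityʳ; ∷-injectiveʳ; length-++; filter-++; filter-none; filter-accept; filter-reject; reverse-++)
open import Data.List.Membership.Propositional using (_∈_; _∉_)
open import Data.List.Membership.Propositional.Properties using (∈-∃++; ∈-++⁻; ∈-++⁺ˡ; ∈-++⁺ʳ)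
open import Data.List.Relation.Unary.Any using (here; there)
open import Data.List.Relation.Unary.All as All using (All; []; _∷_)
import Data.List.Relation.Unary.All.Properties as AllP
open import Data.List.Relation.Unary.AllPairs using ([]; _∷_)
open import Data.List.Relation.Unary.Unique.Propositional using (Unique)
import Data.List.Relation.Unary.Unique.Propositional.Properties as UniqueP
open import Data.List.Relation.Binary.Sublist.Propositional using (_⊆_; []; _∷_; _∷ʳ_; ⊆-refl; minimum)
open import Data.List.Relation.Binary.Sublist.Propositional.Properties using (All-resp-⊆)
  renaming (++⁺ to ⊆-++⁺; ++⁺ˡ to ⊆-++⁺ˡ; ++⁺ʳ to ⊆-++⁺ʳ)
open import Data.List.Relation.Binary.Permutation.Propositional
  using (_↭_; ↭-refl; ↭-sym; ↭-trans; ↭-reflexive; prep; ↭⇒↭ₛ)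
open import Data.List.Relation.Binary.Permutation.Propositional.Properties
  using (filter-↭; ↭-length; ↭-reverse; shift; ∷↭∷ʳ)
  renaming (++⁺ to ↭-++⁺; ++-comm to ↭-++-comm)
import Data.List.Relation.Binary.Permutation.Setoid.Properties as Permₛ
open import Data.Product using (Σ; ∃; ∃₂; _×_; _,_; proj₁; proj₂)
open import Data.Sum using (_⊎_; inj₁; inj₂)
import Data.Sum as Sum
open import Data.Empty using (⊥; ⊥-elim)
open import Relation.Nullary using (yes; no)
open import Relation.Binary.PropositionalEquality
  using (_≡_; _≢_; refl; sym; trans; cong; cong₂; subst; setoid)
open import Function.Bundles using (Equivalence)

Unique-⊆ : {A : Set} {xs ys : List A} → xs ⊆ ys → Unique ys → Unique xs
Unique-⊆ []         _       = []
Unique-⊆ (_ ∷ʳ τ)   (_ ∷ u) = Unique-⊆ τ u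
Unique-⊆ (refl ∷ τ) (h ∷ u) = All-resp-⊆ τ h ∷ Unique-⊆ τ u

Unique-↭ : {A : Set} {xs ys : List A} → xs ↭ ys → Unique xs → Unique ys
Unique-↭ {A} π = Permₛ.Unique-resp-↭ (setoid A) (↭⇒↭ₛ π)

unique-tail : {A : Set} {x : A} {xs : List A} → Unique (x ∷ xs) → Unique xs
unique-tail (_ ∷ u) = u

split-++ : {A : Set} {S L R : List A} {x : A} (C : List A) →
           S ≡ L ++ x ∷ R → S ++ C ≡ L ++ x ∷ R ++ C
split-++ {L = L} {R} {x} C refl = ++-assoc L (x ∷ R) C

module Counting (G : Digraph) (S : Subset (Digraph.n G)) where
  open Digraph G

  Avoids : List (V G) → Set
  Avoids = All (_∉ₛ S)

  count-↭ : {xs ys : List (V G)} → xs ↭ ys → count G xs S ≡ count G ys S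
  count-↭ π = ↭-length (filter-↭ (_∈ₛ? S) π)

  count-∉ : {c : V G} (xs : List (V G)) → c ∉ₛ S → count G (c ∷ xs) S ≡ count G xs S
  count-∉ xs c∉ = cong length (filter-reject (_∈ₛ? S) c∉)

  count-single : ∀ L {x R} → x ∈ₛ S → Avoids L → Avoids R → count G (L ++ x ∷ R) S ≡ 1
  count-single L {x} {R} x∈ avL avR =
    cong length (trans (filter-++ (_∈ₛ? S) L (x ∷ R))
                  (cong₂ _++_ (filter-none (_∈ₛ? S) avL)
                               (trans (filter-accept (_∈ₛ? S) x∈) (cong (x ∷_) (filter-none (_∈ₛ? S) avR)))))

  record FirstIn (xs : List (V G)) : Set where
    field
      before : List (V G)
      elem   : V G
      after  : List (V G)
      split  : xs ≡ before ++ elem ∷ after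
      member : elem ∈ₛ S
      clean  : Avoids before

  record LastIn (xs : List (V G)) : Set where
    field
      before : List (V G)
      elem   : V G
      after  : List (V G)
      split  : xs ≡ before ++ elem ∷ after
      member : elem ∈ₛ S
      clean  : Avoids after

  first-in : ∀ xs → FirstIn xs ⊎ Avoids xs
  first-in [] = inj₂ []
  first-in (y ∷ ys) with y ∈ₛ? S
  ... | yes y∈ = inj₁ (record { before = [] ; split = refl ; member = y∈ ; clean = [] })
  ... | no y∉ with first-in ys
  ...   | inj₂ av = inj₂ (y∉ ∷ av)
  ...   | inj₁ o  = inj₁ (record { before = y ∷ FirstIn.before o ; split = cong (y ∷_) (FirstIn.split o)
                                  ; member = FirstIn.member o ; clean = y∉ ∷ FirstIn.clean o })

  last-in : ∀ xs → LastIn xs ⊎ Avoids xs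
  last-in [] = inj₂ []
  last-in (y ∷ ys) with last-in ys
  ... | inj₁ o  = inj₁ (record { before = y ∷ LastIn.before o ; split = cong (y ∷_) (LastIn.split o)
                                ; member = LastIn.member o ; clean = LastIn.clean o })
  ... | inj₂ av with y ∈ₛ? S
  ...   | yes y∈ = inj₁ (record { before = [] ; split = refl ; member = y∈ ; clean = av })
  ...   | no y∉  = inj₂ (y∉ ∷ av)

module Walks (G : Digraph) where
  open Digraph G

  walk-head : ∀ {a c xs} → Walk G a c xs → ∃ λ ys → xs ≡ a ∷ ys
  walk-head here       = _ , refl
  walk-head (step _ _) = _ , refl

  walk-last : ∀ {a c xs} → Walk G a c xs → ∃ λ ys → xs ≡ ys ++ [ c ]
  walk-last here = [] , refl
  walk-last (step _ w) with walk-last w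
  ... | ys , refl = _ ∷ ys , refl

  walk-end : ∀ {a c xs} → Walk G a c xs → c ∈ xs
  walk-end here       = here refl
  walk-end (step _ w) = there (walk-end w)

  walk-++ : ∀ {a c d xs ys} → Walk G a c xs → Walk G c d (c ∷ ys) → Walk G a d (xs ++ ys)
  walk-++ here       w′ = w′
  walk-++ (step e w) w′ = step e (walk-++ w w′)

  walk-prefix : ∀ {a c} xs {y ys} → Walk G a c (xs ++ y ∷ ys) → Walk G a y (xs ++ [ y ])
  walk-prefix []               here       = here
  walk-prefix []               (step _ _) = here
  walk-prefix (_ ∷ [])         (step e w) = step e (walk-prefix [] w)
  walk-prefix (_ ∷ x′ ∷ xs)    (step e w) = step e (walk-prefix (x′ ∷ xs) w)

  walk-suffix : ∀ {a c} xs {y ys} → Walk G a c (xs ++ y ∷ ys) → Walk G y c (y ∷ ys)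
  walk-suffix [] {y} {ys} w with walk-head w
  ... | _ , refl = w
  walk-suffix (_ ∷ [])      (step _ w) = walk-suffix [] w
  walk-suffix (_ ∷ x′ ∷ xs) (step _ w) = walk-suffix (x′ ∷ xs) w

  walk-initial : ∀ {a c} xs {ys} → Walk G a c (a ∷ xs ++ ys) →
                 ∃ λ y → Walk G a y (a ∷ xs) × y ∈ a ∷ xs
  walk-initial []       w          = _ , here , here refl
  walk-initial (x ∷ xs) (step e w) with walk-head w
  ... | _ , refl with walk-initial xs w
  ...   | y , w′ , y∈ = y , step e w′ , there y∈

  walk-ends : ∀ {a c xs} → Walk G a c xs → 1 ≤ len G xs → ∃ λ I → xs ≡ a ∷ I ++ [ c ]
  walk-ends here       ()
  walk-ends (step _ w) _ with walk-last w
  ... | I , refl = I , refl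

module Alternating (G : Digraph) (b : ℕ) where
  open Digraph G
  open Walks G
  open AltPath

  one-alt : ∀ {c x P} → Walk G c x P → Unique P →
            Σ (AltPath G 1 b) λ R → s R 1 ≡ c × t R 1 ≡ x × verts R ↭ P
  one-alt {c} {x} {P} w u = R , refl , refl , ↭-reflexive (++-identityʳ P)
    where
    R : AltPath G 1 b
    R = record
      { s = λ _ → c ; t = λ _ → x ; Q = λ _ → P ; Q' = λ _ → []
      ; Qpath  = λ { 1 _ _ → w , u ; (suc (suc _)) _ (s≤s ()) }
      ; Q'path = λ { (suc _) _ (s≤s ()) }
      ; Qlen   = λ { (suc (suc _)) _ (s≤s ()) }
      ; Q'len  = λ { (suc _) _ (s≤s ()) }
      ; isPath = subst Unique (sym (++-identityʳ P)) u }

  -- An apex c, a walk W from v to some y with an arc y → c, and a walk v ∷ Z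
  -- from v to x form the (2,b)-alternating path  c ← y ⋯ W ⋯ v → Z → x
  -- (Q₁ = [ c ], Q′₁ = W ++ [ c ], Q₂ = v ∷ Z), provided W is long enough.
  two-alt : ∀ {c v x y W Z} → Walk G v y W → Arc y c → Walk G v x (v ∷ Z) → b ≤ length W →
            Unique (c ∷ W ++ Z) →
            Σ (AltPath G 2 b) λ R → s R 1 ≡ c × t R 2 ≡ x × verts R ↭ c ∷ W ++ Z
  two-alt {c} {v} {x} {y} {W} {Z} wW arc wZ long uniq with walk-head wW
  ... | W′ , refl = R , refl , refl , shape↭
    where
    starts ends : ℕ → V G
    starts 1 = c
    starts _ = v
    ends 1 = c
    ends _ = x

    forward : ℕ → List (V G)
    forward 1 = [ c ]
    forward _ = v ∷ Z

    back : List (V G)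
    back = W ++ [ c ]

    back-walk : Walk G v c back
    back-walk = walk-++ wW (step arc here)

    back-unique : Unique back
    back-unique = Unique-↭ (∷↭∷ʳ c W) (Unique-⊆ (refl ∷ ⊆-++⁺ʳ Z ⊆-refl) uniq)

    forward-unique : Unique (v ∷ Z)
    forward-unique = Unique-⊆ (c ∷ʳ (refl ∷ ⊆-++⁺ˡ W′ ⊆-refl)) uniq

    back-len : len G back ≡ length W
    back-len = trans (cong (_∸ 1) (length-++ W)) (m+n∸n≡m (length W) 1)

    -- The vertex sequence of the path: c, then W backwards, then Z.
    shape↭ : c ∷ drop 1 (reverse back) ++ Z ++ [] ↭ c ∷ W ++ Z
    shape↭ = prep c (↭-++⁺ (↭-trans (↭-reflexive (cong (drop 1) (reverse-++ W [ c ]))) (↭-reverse W))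
                           (↭-reflexive (++-identityʳ Z)))

    R : AltPath G 2 b
    R = record
      { s = starts ; t = ends ; Q = forward ; Q' = λ _ → back
      ; Qpath  = λ { 1 _ _ → here , [] ∷ [] ; 2 _ _ → wZ , forward-unique
                   ; (suc (suc (suc _))) _ (s≤s (s≤s ())) }
      ; Q'path = λ { 1 _ _ → back-walk , back-unique ; (suc (suc _)) _ (s≤s (s≤s ())) }
      ; Qlen   = λ { 1 (s≤s ()) _ ; (suc (suc _)) _ (s≤s (s≤s ())) }
      ; Q'len  = λ { 1 _ _ → subst (b ≤_) (sym back-len) long ; (suc (suc _)) _ (s≤s (s≤s ())) }
      ; isPath = Unique-↭ (↭-sym shape↭) uniq }

length-bound : ∀ b → 1 ≤ b → b ≤ 2 * (b * b) + b ∸ 2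
length-bound b hb = subst (b ≤_) (sym (+-∸-comm b two≤)) (m≤n+m b _)
  where
  two≤ : 2 ≤ 2 * (b * b)
  two≤ = *-monoʳ-≤ 2 (*-mono-≤ hb hb)

P₁-long : ∀ {b G} → 1 ≤ b → (E : ExtTypeII G b) → b ≤ len G (ExtTypeII.P₁ E)
P₁-long {b} hb E = ≤-trans (length-bound b hb) (ExtTypeII.P₁len E)

-- An extended type-II gadget whose path P₁ is written r ∷ I ++ [ p ]
-- (possible since P₁ has at least b ≥ 1 arcs).
module ExtendedGadget {b : ℕ} (hb : 1 ≤ b) {G : Digraph} (E : ExtTypeII G b) (I : List (V G))
  (P₁-shape : ExtTypeII.P₁ E ≡ ExtTypeII.r E ∷ I ++ [ ExtTypeII.p E ]) where
  open Digraph G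
  open ExtTypeII E
  open Walks G
  open Alternating G b
  open AltPath

  -- P₂ followed by the interior of P₁: all vertices except p and q.
  spine : List (V G)
  spine = P₂ ++ I

  walk₁ : Walk G r p (r ∷ I ++ [ p ])
  walk₁ = subst (Walk G r p) P₁-shape (proj₁ P₁path)

  walk₂ : Walk G u r P₂
  walk₂ = proj₁ P₂path

  unique₁ : Unique (r ∷ I ++ [ p ])
  unique₁ = subst Unique P₁-shape (proj₂ P₁path)

  extra-arc : Arc ex ey
  extra-arc = Equivalence.from (arcs ex ey) (inj₂ (inj₂ (inj₂ (refl , refl))))

  in-P₁ : ∀ {v} → v ∈ r ∷ I ++ [ p ] → v ∈ P₁
  in-P₁ = subst (_ ∈_) (sym P₁-shape)

  I-long : b ≤ length (r ∷ I)
  I-long = subst (b ≤_) (trans (length-++ I) (+-comm (length I) 1))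
                 (subst (λ P → b ≤ len G P) P₁-shape (P₁-long hb E))

  P₂-long : b ≤ length P₂
  P₂-long = ≤-trans P₂len (m∸n≤m (length P₂) 1)

  to-q : ∀ {v} → v ∈ r ∷ I → Arc v q
  to-q {v} v∈ = Equivalence.from (arcs v q) (inj₂ (inj₂ (inj₁ (in-P₁ (lift v∈) , refl))))
    where
    lift : v ∈ r ∷ I → v ∈ r ∷ I ++ [ p ]
    lift (here e)  = here e
    lift (there k) = there (∈-++⁺ˡ k)

  P₂-disjoint : ∀ {v} → v ∈ P₂ → v ∈ I ++ [ p ] → ⊥
  P₂-disjoint {v} v∈P₂ v∈ =
    UniqueP.Unique[x∷xs]⇒x∉xs unique₁ (subst (_∈ I ++ [ p ]) (P₁∩P₂ v (in-P₁ (there v∈)) v∈P₂) v∈)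

  distinct : Unique (q ∷ p ∷ spine)
  distinct = Unique-↭ (prep q (↭-trans (↭-reflexive (sym (++-assoc P₂ I [ p ]))) (↭-sym (∷↭∷ʳ p spine))))
                      (AllP.¬Any⇒All¬ _ q∉ ∷ UniqueP.++⁺ (proj₂ P₂path) (unique-tail unique₁) λ (a , c) → P₂-disjoint a c)
    where
    q∉ : q ∉ P₂ ++ I ++ [ p ]
    q∉ m with ∈-++⁻ P₂ m
    ... | inj₁ k = q∉P₂ k
    ... | inj₂ k = q∉P₁ (in-P₁ (there k))

  PQ : Subset n
  PQ = ⁅ p ⁆ ∪ ⁅ q ⁆

  pq-in-PQ : ∀ {c} → c ≡ p ⊎ c ≡ q → c ∈ₛ PQ
  pq-in-PQ (inj₁ refl) = p⊆p∪q ⁅ q ⁆ (x∈⁅x⁆ p)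
  pq-in-PQ (inj₂ refl) = q⊆p∪q ⁅ p ⁆ ⁅ q ⁆ (x∈⁅x⁆ q)

  spine-avoids-PQ : All (_∉ₛ PQ) spine
  spine-avoids-PQ = All.tabulate λ v∈ v∈PQ → case-PQ v∈ (x∈p∪q⁻ ⁅ p ⁆ ⁅ q ⁆ v∈PQ)
    where
    case-PQ : ∀ {v} → v ∈ spine → v ∈ₛ ⁅ p ⁆ ⊎ v ∈ₛ ⁅ q ⁆ → ⊥
    case-PQ v∈ (inj₁ v∈p) = UniqueP.Unique[x∷xs]⇒x∉xs (unique-tail distinct)
                              (subst (_∈ spine) (x∈⁅y⁆⇒x≡y p v∈p) v∈)
    case-PQ v∈ (inj₂ v∈q) = UniqueP.Unique[x∷xs]⇒x∉xs distinct
                              (there (subst (_∈ spine) (x∈⁅y⁆⇒x≡y q v∈q) v∈))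

  record Realisation (x : V G) (N : List (V G)) : Set where
    field
      order     : ℕ
      small     : order ≡ 1 ⊎ order ≡ 2
      path      : AltPath G order b
      apex      : V G
      apex-pq   : apex ≡ p ⊎ apex ≡ q
      starts    : s path 1 ≡ apex
      ends      : t path order ≡ x
      footprint : verts path ↭ apex ∷ N
      on-spine  : N ⊆ spine

  realise₁ : ∀ {x N} → Walk G p x (p ∷ N) → N ⊆ spine → Realisation x N
  realise₁ w τ with one-alt w (Unique-⊆ (q ∷ʳ (refl ∷ τ)) distinct)
  ... | R , s≡ , t≡ , fp = record
    { order = 1 ; small = inj₁ refl ; path = R ; apex = p ; apex-pq = inj₁ refl
    ; starts = s≡ ; ends = t≡ ; footprint = fp ; on-spine = τ }

  -- A walk W from v back to a vertex of r ∷ I (hence with an arc to q) and a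
  -- walk v ∷ Z forward to x realise x over any rearrangement N of W ++ Z.
  realise₂ : ∀ {v x y W Z N} → Walk G v y W → y ∈ r ∷ I → Walk G v x (v ∷ Z) →
             b ≤ length W → W ++ Z ↭ N → N ⊆ spine → Realisation x N
  realise₂ wW y∈ wZ long π τ
    with two-alt wW (to-q y∈) wZ long (Unique-↭ (prep q (↭-sym π)) (Unique-⊆ (refl ∷ (p ∷ʳ τ)) distinct))
  ... | R , s≡ , t≡ , fp = record
    { order = 2 ; small = inj₂ refl ; path = R ; apex = q ; apex-pq = inj₂ refl
    ; starts = s≡ ; ends = t≡ ; footprint = ↭-trans fp (prep q π) ; on-spine = τ }

  Reaches : V G → Set
  Reaches x = ∃ λ a → (a ≡ 1 ⊎ a ≡ 2) × Σ (AltPath G a b) λ R →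
    t R a ≡ x × (s R 1 ≡ p ⊎ s R 1 ≡ q) × count G (verts R) PQ ≡ 1

  ReachesOnce : Subset n → Set
  ReachesOnce X = ∃ λ a → (a ≡ 1 ⊎ a ≡ 2) × Σ (AltPath G a b) λ R →
    t R a ∈ₛ X × (s R 1 ≡ p ⊎ s R 1 ≡ q) × count G (verts R) PQ ≡ 1 × count G (verts R) X ≡ 1

  module _ {x N} (ρ : Realisation x N) where
    open Realisation ρ

    starts-pq : s path 1 ≡ p ⊎ s path 1 ≡ q
    starts-pq = Sum.map (trans starts) (trans starts) apex-pq

    meets-PQ-once : count G (verts path) PQ ≡ 1
    meets-PQ-once = trans (Counting.count-↭ G PQ footprint)
      (Counting.count-single G PQ [] (pq-in-PQ apex-pq) [] (All-resp-⊆ on-spine spine-avoids-PQ))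

    reaches : Reaches x
    reaches = order , small , path , ends , starts-pq , meets-PQ-once

    -- For X inside the interior of P₁ the apex is not in X, so the path
    -- meets X exactly as N does.
    reaches-once : {X : Subset n} → (∀ {v} → v ∈ₛ X → v ∈ I) → x ∈ₛ X → count G N X ≡ 1 →
                   ReachesOnce X
    reaches-once {X} X⊆I x∈ once =
      order , small , path , subst (_∈ₛ X) (sym ends) x∈ , starts-pq , meets-PQ-once ,
      trans (Counting.count-↭ G X footprint) (trans (Counting.count-∉ G X N apex∉) once)
      where
      apex∉ : apex ∉ₛ X
      apex∉ a∈ = All.lookup spine-avoids-PQ (∈-++⁺ʳ P₂ (X⊆I a∈)) (pq-in-PQ apex-pq)

  -- Vertices on P₂: from x run along P₂ to r and on through the interior of P₁,
  -- then jump to q; this backward path has at least |r ∷ I| ≥ b arcs.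
  from-P₂ : ∀ {x} → x ∈ P₂ → ∃ (Realisation x)
  from-P₂ {x} x∈ with ∈-∃++ x∈ | walk-initial I walk₁
  ... | A , B , P₂≡ | y , w-y , y∈ =
    _ , realise₂ (walk-++ w-x w-y) y∈ here long (↭-reflexive (++-identityʳ _)) τ
    where
    w-x : Walk G x r (x ∷ B)
    w-x = walk-suffix A (subst (Walk G u r) P₂≡ walk₂)
    long : b ≤ length ((x ∷ B) ++ I)
    long = ≤-trans I-long (s≤s (subst (length I ≤_) (sym (length-++ B)) (m≤n+m (length I) (length B))))
    τ : (x ∷ B) ++ I ⊆ spine
    τ = subst (λ P → (x ∷ B) ++ I ⊆ P ++ I) (sym P₂≡) (⊆-++⁺ (⊆-++⁺ˡ A ⊆-refl) ⊆-refl)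

  data Shortcut : Set where
    enter-interior : Walk G u p (u ∷ I ++ [ p ]) → Shortcut          -- u → second vertex of P₁
    leave-p        : Arc p u → Shortcut
    leave-interior : ∀ {e} → e ∈ I → Arc e u → Shortcut

  -- The arc from ex = u to the second vertex of P₁ extends the walk P₁ minus r.
  shortcut : Shortcut
  shortcut with extra
  ... | inj₁ (ex≡u , rest , P₁≡) = enter-interior (subst (λ P → Walk G u p (u ∷ P)) (sym tail≡) (step arc w))
    where
    tail≡ : I ++ [ p ] ≡ ey ∷ rest
    tail≡ = ∷-injectiveʳ (trans (sym P₁-shape) P₁≡)
    arc : Arc u ey
    arc = subst (λ v → Arc v ey) ex≡u extra-arc
    w : Walk G ey p (ey ∷ rest)
    w = walk-suffix [ r ] (subst (λ P → Walk G r p (r ∷ P)) tail≡ walk₁)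
  ... | inj₂ (ey≡u , ex∈ , ex≢r) with subst (ex ∈_) P₁-shape ex∈
  ...   | here ex≡r = ⊥-elim (ex≢r ex≡r)
  ...   | there k with ∈-++⁻ I k
  ...     | inj₁ ex∈I         = leave-interior ex∈I (subst (Arc ex) ey≡u extra-arc)
  ...     | inj₂ (here ex≡p)  = leave-p (subst (λ v → Arc v u) ex≡p (subst (Arc ex) ey≡u extra-arc))

  walk-to : ∀ {a L x R} → Walk G a p (a ∷ I ++ [ p ]) → I ≡ L ++ x ∷ R → Walk G a x (a ∷ L ++ [ x ])
  walk-to {a} {L} w I≡ = walk-prefix (a ∷ L) (subst (λ P → Walk G a p (a ∷ P)) (split-++ [ p ] I≡) w)

  walk-from : ∀ {K e M L x R} → I ≡ K ++ e ∷ M → e ∷ M ≡ L ++ x ∷ R →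
              ∃ λ Y → L ++ [ x ] ≡ e ∷ Y × Walk G e x (e ∷ Y)
  walk-from {K} {e} {M} {L} {x} I≡ eM≡ = Y , Y≡ , subst (Walk G e x) Y≡ w-x
    where
    w-e : Walk G e p (e ∷ M ++ [ p ])
    w-e = walk-suffix (r ∷ K) (subst (λ P → Walk G r p (r ∷ P)) (split-++ [ p ] I≡) walk₁)
    w-x : Walk G e x (L ++ [ x ])
    w-x = walk-prefix L (subst (Walk G e p) (split-++ [ p ] eM≡) w-e)
    Y : List (V G)
    Y = proj₁ (walk-head w-x)
    Y≡ : L ++ [ x ] ≡ e ∷ Y
    Y≡ = proj₂ (walk-head w-x)

  segment-on-spine : ∀ K L {x R} → I ≡ K ++ L ++ x ∷ R → P₂ ++ L ++ [ x ] ⊆ spine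
  segment-on-spine K L {x} {R} I≡ =
    subst (λ J → P₂ ++ L ++ [ x ] ⊆ P₂ ++ J) (sym I≡)
          (⊆-++⁺ (⊆-refl {x = P₂}) (⊆-++⁺ˡ K (⊆-++⁺ (⊆-refl {x = L}) (refl ∷ minimum R))))

  module Selection (X : Subset n) (X⊆I : ∀ {v} → v ∈ₛ X → v ∈ I) where
    open Counting G X

    Witness : Set
    Witness = ∃₂ λ x N → Realisation x N × x ∈ₛ X × count G N X ≡ 1

    P₂-avoids : Avoids P₂
    P₂-avoids = All.tabulate λ v∈ v∈X → P₂-disjoint v∈ (∈-++⁺ˡ (X⊆I v∈X))

    segment-once : ∀ L {x} → Avoids L → x ∈ₛ X → count G (P₂ ++ L ++ [ x ]) X ≡ 1
    segment-once L {x} av x∈ =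
      subst (λ N → count G N X ≡ 1) (++-assoc P₂ L [ x ]) (count-single (P₂ ++ L) x∈ (AllP.++⁺ P₂-avoids av) [])

    -- Arc u → second vertex of P₁: go from q back along P₂ to u, then forward
    -- along P₁ to the first vertex x of X.
    via-entry : Walk G u p (u ∷ I ++ [ p ]) → FirstIn I → Witness
    via-entry w o = elem , _ ,
      realise₂ walk₂ (here refl) (walk-to w split) P₂-long ↭-refl (segment-on-spine [] before split) ,
      member , segment-once before clean member
      where open FirstIn o

    -- Arc p → u: the directed path p → P₂ → P₁ up to the first vertex x of X.
    via-p : Arc p u → FirstIn I → Witness
    via-p arc o = elem , _ ,
      realise₁ (step arc (walk-++ walk₂ (walk-to walk₁ split))) (segment-on-spine [] before split) ,
      member , segment-once before clean member
      where open FirstIn o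

    -- Arc e → u with an element of X at or after e: go from q back along P₂
    -- and the arc to e, then forward along P₁ to the first such x.
    via-forward : ∀ {e K M} → I ≡ K ++ e ∷ M → Arc e u → FirstIn (e ∷ M) → Witness
    via-forward {e} {K} I≡ arc o with walk-from I≡ (FirstIn.split o)
    ... | Y , Y≡ , w = elem , _ ,
      realise₂ (step arc walk₂) (here refl) w (≤-trans P₂-long (n≤1+n _))
               (↭-trans (↭-sym (shift e P₂ Y)) (↭-reflexive (cong (P₂ ++_) (sym Y≡))))
               (segment-on-spine K before (trans I≡ (cong (K ++_) split))) ,
      member , segment-once before clean member
      where open FirstIn o

    -- Arc e → u with no element of X at or after e: take the last x ∈ X before e,
    -- go from q back along P₂ and the arc to e, then back along P₁ to x.
    via-backward : ∀ {e K M} → I ≡ K ++ e ∷ M → Arc e u → Avoids (e ∷ M) → LastIn K → Witness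
    via-backward {e} {K} {M} I≡ arc avM o =
      elem , _ , realise₂ (walk-++ w-x (step arc walk₂)) (here refl) here long π τ , member , once
      where
      open LastIn o
      w-x : Walk G elem e (elem ∷ after ++ [ e ])
      w-x = walk-suffix (r ∷ before) (subst (λ P → Walk G r e (r ∷ P)) (split-++ [ e ] split) (walk-to walk₁ I≡))
      long : b ≤ length ((elem ∷ after ++ [ e ]) ++ P₂)
      long = ≤-trans P₂-long (subst (length P₂ ≤_) (sym (length-++ (elem ∷ after ++ [ e ]))) (m≤n+m _ _))
      π : ((elem ∷ after ++ [ e ]) ++ P₂) ++ [] ↭ P₂ ++ elem ∷ after ++ [ e ]
      π = ↭-trans (↭-reflexive (++-identityʳ _)) (↭-++-comm (elem ∷ after ++ [ e ]) P₂)
      τ : P₂ ++ elem ∷ after ++ [ e ] ⊆ spine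
      τ = segment-on-spine before (elem ∷ after)
            (trans I≡ (trans (cong (_++ e ∷ M) split) (++-assoc before (elem ∷ after) (e ∷ M))))
      once : count G (P₂ ++ elem ∷ after ++ [ e ]) X ≡ 1
      once = count-single P₂ member P₂-avoids (AllP.++⁺ clean (All.head avM ∷ []))

    first-of-I : ∀ {v} → v ∈ₛ X → FirstIn I
    first-of-I v∈ with first-in I
    ... | inj₁ o  = o
    ... | inj₂ av = ⊥-elim (All.lookup av (X⊆I v∈) v∈)

    -- Case analysis on the additional arc; if it leaves e ∈ I and X has no
    -- element from e onwards, then X meets the part of I before e.
    select : ∀ {v} → v ∈ₛ X → Witness
    select v∈ with shortcut
    ... | enter-interior w = via-entry w (first-of-I v∈)
    ... | leave-p arc      = via-p arc (first-of-I v∈)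
    ... | leave-interior {e} e∈ arc with ∈-∃++ e∈
    ...   | K , M , I≡ with first-in (e ∷ M)
    ...     | inj₁ o   = via-forward I≡ arc o
    ...     | inj₂ avM with last-in K
    ...       | inj₁ o   = via-backward I≡ arc avM o
    ...       | inj₂ avK = ⊥-elim (All.lookup (subst Avoids (sym I≡) (AllP.++⁺ avK avM)) (X⊆I v∈) v∈)

  on-P₁ : ∀ {v} → v ∈ P₁ → v ≢ p → v ≡ r ⊎ v ∈ I
  on-P₁ v∈ v≢p with subst (_ ∈_) P₁-shape v∈
  ... | here v≡r = inj₁ v≡r
  ... | there k with ∈-++⁻ I k
  ...   | inj₁ v∈I        = inj₂ v∈I
  ...   | inj₂ (here v≡p) = ⊥-elim (v≢p v≡p)

  interior : ∀ {X : Subset n} → (∀ v → v ∈ₛ X → v ∈ P₁ × v ≢ p × v ≢ r) → ∀ {v} → v ∈ₛ X → v ∈ I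
  interior hyp {v} v∈ with hyp v v∈
  ... | v∈P₁ , v≢p , v≢r with on-P₁ v∈P₁ v≢p
  ...   | inj₁ v≡r = ⊥-elim (v≢r v≡r)
  ...   | inj₂ v∈I = v∈I

  part-two : ∀ X → Nonempty X → (∀ v → v ∈ₛ X → v ∈ P₁ × v ≢ p × v ≢ r) → ReachesOnce X
  part-two X (v , v∈) hyp with Selection.select X (interior hyp) v∈
  ... | x , N , ρ , x∈ , once = reaches-once ρ (interior hyp) x∈ once

  reach-interior : ∀ {x} → x ∈ I → Reaches x
  reach-interior {x} x∈I
    with Selection.select ⁅ x ⁆ (λ v∈ → subst (_∈ I) (sym (x∈⁅y⁆⇒x≡y x v∈)) x∈I) (x∈⁅x⁆ x)
  ... | x′ , N , ρ , x′∈ , _ = subst Reaches (x∈⁅y⁆⇒x≡y x x′∈) (reaches ρ)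

  part-one : ∀ x → x ≢ p → x ≢ q → Reaches x
  part-one x x≢p x≢q with vertices x
  ... | inj₂ (inj₁ x∈P₂) = reaches (proj₂ (from-P₂ x∈P₂))
  ... | inj₂ (inj₂ x≡q)  = ⊥-elim (x≢q x≡q)
  ... | inj₁ x∈P₁ with on-P₁ x∈P₁ x≢p
  ...   | inj₂ x∈I = reach-interior x∈I
  ...   | inj₁ x≡r = reaches (proj₂ (from-P₂ (subst (_∈ P₂) (sym x≡r) (walk-end walk₂))))

lemma2p5 : (b : ℕ) → 1 ≤ b → (G : Digraph) → (E : ExtTypeII G b) →
    let open Digraph G
        open ExtTypeII E
        open AltPath
    in
    (∀ (x : V G) → x ≢ p → x ≢ q →
      ∃ λ a → (a ≡ 1 ⊎ a ≡ 2) × Σ (AltPath G a b) λ R →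
        t R a ≡ x × (s R 1 ≡ p ⊎ s R 1 ≡ q) × count G (verts R) (⁅ p ⁆ ∪ ⁅ q ⁆) ≡ 1)
    ×
    (∀ (X : Subset n) → Nonempty X → (∀ v → v ∈ₛ X → v ∈ P₁ × v ≢ p × v ≢ r) →
      ∃ λ a → (a ≡ 1 ⊎ a ≡ 2) × Σ (AltPath G a b) λ R →
        t R a ∈ₛ X × (s R 1 ≡ p ⊎ s R 1 ≡ q)
        × count G (verts R) (⁅ p ⁆ ∪ ⁅ q ⁆) ≡ 1 × count G (verts R) X ≡ 1)
lemma2p5 b hb G E with Walks.walk-ends G (proj₁ (ExtTypeII.P₁path E)) (≤-trans hb (P₁-long hb E))
... | I , P₁-shape = part-one , part-two
  where open ExtendedGadget hb E I P₁-shape
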